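{- Let $G$ be a finite graph with $m\ge 1$ edges and let $f(q)=R(G)(q)=\sum_{i=0}^m N_i(1-q)^iq^{m-i}$ be its reliability polynomial, where $N_i$ is the number of connected spanning subgraphs of $G$ with exactly $i$ edges. Then $f'(q)$ can be written in the form $f'(q)=\sum_{i=0}^{m-1} M_i (1-q)^i q^{m-1-i}$ where all coefficients $M_i$ are non-positive.
   Context: The reliability polynomial $R(G)(q)$ of a finite graph $G$ is the probability that $G$ remains connected when each edge fails independently with probability $q$; it equals $\sum_{i=0}^m N_i(1-q)^iq^{m-i}$ with $N_i$ as in the claim. -}

module Defs where

open import Data.Nat as ℕ using (ℕ; zero; suc)
open import Data.Integer as ℤ using (ℤ; +_)
open import Data.Fin using (Fin)
open import Data.Fin.Subset using (Subset; _∈_; ∣_∣; inside; outside)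
open import Data.Vec using (_∷_; [])
open import Data.List as List using (List; []; _∷_; _++_; map; filter; length; foldr)
open import Data.Product using (_×_; _,_; proj₁; proj₂; ∃)
open import Data.Sum using (_⊎_)
open import Relation.Nullary using (Dec)
open import Relation.Nullary.Decidable using (_×-dec_)
open import Relation.Binary.PropositionalEquality using (_≡_)

-- Finite (multi)graphs: n vertices Fin n, m edges Fin m, each edge
-- given by its (unordered) pair of endpoints.  Loops and parallel
-- edges are allowed.

Graph : ℕ → ℕ → Set
Graph n m = Fin m → Fin n × Fin n

-- A spanning subgraph of G is determined by its edge set S ⊆ E(G).
-- Reachability of v from u using only edges of S.
data Reach {n m : ℕ} (G : Graph n m) (S : Subset m) (u : Fin n) : Fin n → Set where
  here : Reach G S u u
  step : ∀ {v w} (e : Fin m) → e ∈ S →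
         (G e ≡ (v , w)) ⊎ (G e ≡ (w , v)) →
         Reach G S u v → Reach G S u w

Connected : {n m : ℕ} → Graph n m → Subset m → Set
Connected G S = ∀ u v → Reach G S u v

allSubsets : (m : ℕ) → List (Subset m)
allSubsets zero    = [] ∷ []
allSubsets (suc m) = map (inside ∷_) (allSubsets m) ++ map (outside ∷_) (allSubsets m)

-- The count is taken w.r.t. a decision procedure for connectivity; since
-- Connected G S is a fixed (in)habited type, every decider gives the
-- same count.
Ncount : {n m : ℕ} (G : Graph n m) → (∀ S → Dec (Connected G S)) → ℕ → ℕ
Ncount {m = m} G conn? i =
  length (filter (λ S → conn? S ×-dec (∣ S ∣ ℕ.≟ i)) (allSubsets m))

-- Univariate polynomials over ℤ as coefficient lists (lowest degree first).

Poly : Set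
Poly = List ℤ

infixl 6 _⊕_
infixl 7 _⊗_

_⊕_ : Poly → Poly → Poly
[]       ⊕ q        = q
(a ∷ p)  ⊕ []       = a ∷ p
(a ∷ p)  ⊕ (b ∷ q)  = (a ℤ.+ b) ∷ (p ⊕ q)

scale : ℤ → Poly → Poly
scale c = map (c ℤ.*_)

_⊗_ : Poly → Poly → Poly
[]      ⊗ q = []
(a ∷ p) ⊗ q = scale a q ⊕ (+ 0 ∷ (p ⊗ q))

constP : ℤ → Poly
constP c = c ∷ []

X : Poly
X = + 0 ∷ + 1 ∷ []

oneMinusX : Poly
oneMinusX = + 1 ∷ ℤ.- (+ 1) ∷ []

_^P_ : Poly → ℕ → Poly
p ^P zero  = constP (+ 1)
p ^P suc k = p ⊗ (p ^P k)

derivFrom : ℕ → Poly → Poly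
derivFrom k []      = []
derivFrom k (a ∷ p) = (+ k ℤ.* a) ∷ derivFrom (suc k) p

deriv : Poly → Poly
deriv []      = []
deriv (a ∷ p) = derivFrom 1 p

eval : Poly → ℤ → ℤ
eval []      x = + 0
eval (a ∷ p) x = a ℤ.+ x ℤ.* eval p x

sumP : ℕ → (ℕ → Poly) → Poly
sumP zero    t = []
sumP (suc k) t = sumP k t ⊕ t k

bernsteinForm : ℕ → (ℕ → ℤ) → Poly
bernsteinForm d c = sumP (suc d) (λ i → scale (c i) ((oneMinusX ^P i) ⊗ (X ^P (d ℕ.∸ i))))

reliability : {n m : ℕ} (G : Graph n m) → (∀ S → Dec (Connected G S)) → Poly
reliability {m = m} G conn? = bernsteinForm m (λ i → + Ncount G conn? i)

-- Differentiating the Bernstein form termwise, with (1 - q)^i q^(m-i) having derivative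
-- (m - i)(1 - q)^i q^(m-1-i) - i (1 - q)^(i-1) q^(m-i), and collecting coefficients gives
-- f'(q) = Σ_j M_j (1 - q)^j q^(m-1-j) with M_j = (m - j) N_j - (j + 1) N_(j+1).
-- Adding edges preserves connectivity, so the connected edge sets form an up-set in the
-- Boolean lattice of E(G), and every up-set satisfies the local LYM inequality
-- (m - j) N_j ≤ (j + 1) N_(j+1): adding one of the m - j missing edges to a member of size j
-- gives a member of size j + 1, and each of those arises at most j + 1 times.  Here that
-- inequality is proved by induction on m instead, splitting the family according to whether
-- its sets contain the first element.

module Submission where

open import Defs
open import Data.Nat as ℕ using (ℕ; zero; suc; _∸_; _≥_; z≤n)
import Data.Nat.Properties as ℕ
import Data.Nat.Tactic.RingSolver as ℕ-Solver
open import Data.Integer using (ℤ; +_; _+_; _*_; _-_; -_; _≤_; +≤+)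
import Data.Integer.Properties as ℤ
open import Data.Integer.Tactic.RingSolver using (solve-∀)
open import Data.Fin.Subset using (Subset; _⊆_; ∣_∣; inside; outside)
open import Data.Fin.Subset.Properties using (s⊆s; out⊆; ⊆-refl)
open import Data.Vec using (_∷_)
open import Data.List using (List; []; _∷_; _++_; map; filter; length)
import Data.List.Properties as List
import Data.List.Relation.Unary.All as All
open import Data.List.Relation.Binary.Sublist.Propositional as Sublist using ()
open import Data.List.Relation.Binary.Sublist.Propositional.Properties using (filter⁺; length-mono-≤)
open import Data.Product using (_×_; _,_; ∃)
open import Function using (_∘_)
open import Relation.Nullary using (Dec; yes; no)
open import Relation.Nullary.Decidable using (_×-dec_)
open import Relation.Unary using (Decidable)
open import Relation.Binary.PropositionalEquality using (_≡_; refl; sym; trans; cong; cong₂; module ≡-Reasoning)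

module _ {A B : Set} {P : A → Set} (P? : Decidable P) (f : B → A) where

  length-filter-map : ∀ xs → length (filter P? (map f xs)) ≡ length (filter (P? ∘ f) xs)
  length-filter-map []       = refl
  length-filter-map (x ∷ xs) with P? (f x)
  ... | yes _ = cong suc (length-filter-map xs)
  ... | no  _ = length-filter-map xs

UpwardClosed : ∀ {m} → (Subset m → Set) → Set
UpwardClosed P = ∀ {S T} → S ⊆ T → P S → P T

ofSize : ∀ {m} {P : Subset m → Set} → Decidable P → (j : ℕ) → Decidable (λ S → P S × ∣ S ∣ ≡ j)
ofSize P? j S = P? S ×-dec (∣ S ∣ ℕ.≟ j)

countOfSize : ∀ {m} {P : Subset m → Set} → Decidable P → ℕ → ℕ
countOfSize {m} P? j = length (filter (ofSize P? j) (allSubsets m))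

countOfSize-mono : ∀ {m} {P Q : Subset m → Set} (P? : Decidable P) (Q? : Decidable Q) →
                   (∀ {S} → P S → Q S) → ∀ j → countOfSize P? j ℕ.≤ countOfSize Q? j
countOfSize-mono {m} P? Q? P⇒Q j = length-mono-≤
  (filter⁺ (ofSize P? j) (ofSize Q? j) (λ { refl (p , e) → P⇒Q p , e }) (Sublist.⊆-refl {x = allSubsets m}))

module _ {m} {P : Subset (suc m) → Set} (P? : Decidable P) where

  countOfSize-split : ∀ j → countOfSize P? j ≡
    length (filter (ofSize P? j ∘ (inside ∷_)) (allSubsets m)) ℕ.+ countOfSize (P? ∘ (outside ∷_)) j
  countOfSize-split j = begin
    length (filter (ofSize P? j) (insides ++ outsides))
      ≡⟨ cong length (List.filter-++ (ofSize P? j) insides outsides) ⟩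
    length (filter (ofSize P? j) insides ++ filter (ofSize P? j) outsides)
      ≡⟨ List.length-++ (filter (ofSize P? j) insides) ⟩
    length (filter (ofSize P? j) insides) ℕ.+ length (filter (ofSize P? j) outsides)
      ≡⟨ cong₂ ℕ._+_ (length-filter-map (ofSize P? j) (inside ∷_) (allSubsets m))
                     (length-filter-map (ofSize P? j) (outside ∷_) (allSubsets m)) ⟩
    length (filter (ofSize P? j ∘ (inside ∷_)) (allSubsets m)) ℕ.+ countOfSize (P? ∘ (outside ∷_)) j ∎
    where
    open ≡-Reasoning
    insides outsides : List (Subset (suc m))
    insides  = map (inside ∷_) (allSubsets m)
    outsides = map (outside ∷_) (allSubsets m)

  countOfSize-zero : countOfSize P? 0 ≡ countOfSize (P? ∘ (outside ∷_)) 0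
  countOfSize-zero = trans (countOfSize-split 0) (cong (ℕ._+ countOfSize (P? ∘ (outside ∷_)) 0) none-inside)
    where
    none-inside : length (filter (ofSize P? 0 ∘ (inside ∷_)) (allSubsets m)) ≡ 0
    none-inside = cong length
      (List.filter-none (ofSize P? 0 ∘ (inside ∷_)) (All.universal (λ _ → λ { (_ , ()) }) (allSubsets m)))

  countOfSize-suc : ∀ k → countOfSize P? (suc k) ≡
    countOfSize (P? ∘ (inside ∷_)) k ℕ.+ countOfSize (P? ∘ (outside ∷_)) (suc k)
  countOfSize-suc k =
    trans (countOfSize-split (suc k)) (cong (ℕ._+ countOfSize (P? ∘ (outside ∷_)) (suc k)) drop-inside)
    where
    drop-inside : length (filter (ofSize P? (suc k) ∘ (inside ∷_)) (allSubsets m))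
                ≡ countOfSize (P? ∘ (inside ∷_)) k
    drop-inside = cong length (List.filter-≐ (ofSize P? (suc k) ∘ (inside ∷_)) (ofSize (P? ∘ (inside ∷_)) k)
      ((λ (p , e) → p , ℕ.suc-injective e) , (λ (p , e) → p , cong suc e)) (allSubsets m))

m∸n≤1+[m∸[1+n]] : ∀ m n → m ∸ n ℕ.≤ suc (m ∸ suc n)
m∸n≤1+[m∸[1+n]] zero    zero    = z≤n
m∸n≤1+[m∸[1+n]] zero    (suc n) = z≤n
m∸n≤1+[m∸[1+n]] (suc m) zero    = ℕ.≤-refl
m∸n≤1+[m∸[1+n]] (suc m) (suc n) = m∸n≤1+[m∸[1+n]] m n

upwardClosed⇒localLYM : ∀ m {P : Subset m → Set} (P? : Decidable P) → UpwardClosed P →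
  ∀ j → (m ∸ j) ℕ.* countOfSize P? j ℕ.≤ suc j ℕ.* countOfSize P? (suc j)
upwardClosed⇒localLYM zero    P? _ zero    = z≤n
upwardClosed⇒localLYM zero    P? _ (suc j) = z≤n
upwardClosed⇒localLYM (suc m) P? up = lym
  where
  a b : ℕ → ℕ
  a = countOfSize (P? ∘ (inside ∷_))
  b = countOfSize (P? ∘ (outside ∷_))

  a-lym : ∀ k → (m ∸ k) ℕ.* a k ℕ.≤ suc k ℕ.* a (suc k)
  a-lym = upwardClosed⇒localLYM m (P? ∘ (inside ∷_)) (up ∘ s⊆s)

  b-lym : ∀ k → (m ∸ k) ℕ.* b k ℕ.≤ suc k ℕ.* b (suc k)
  b-lym = upwardClosed⇒localLYM m (P? ∘ (outside ∷_)) (up ∘ s⊆s)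

  b≤a : ∀ k → b k ℕ.≤ a k
  b≤a = countOfSize-mono (P? ∘ (outside ∷_)) (P? ∘ (inside ∷_)) (up (out⊆ ⊆-refl))

  open ℕ.≤-Reasoning

  lym : ∀ j → (suc m ∸ j) ℕ.* countOfSize P? j ℕ.≤ suc j ℕ.* countOfSize P? (suc j)
  lym zero rewrite countOfSize-zero P? | countOfSize-suc P? 0 = begin
    b 0 ℕ.+ m ℕ.* b 0   ≤⟨ ℕ.+-mono-≤ (b≤a 0) (b-lym 0) ⟩
    a 0 ℕ.+ 1 ℕ.* b 1   ≡⟨ cong (a 0 ℕ.+_) (ℕ.*-identityˡ (b 1)) ⟩
    a 0 ℕ.+ b 1         ≡⟨ ℕ.*-identityˡ (a 0 ℕ.+ b 1) ⟨
    1 ℕ.* (a 0 ℕ.+ b 1) ∎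
  lym (suc k) rewrite countOfSize-suc P? k | countOfSize-suc P? (suc k) = begin
    (m ∸ k) ℕ.* (a k ℕ.+ b (suc k))
      ≡⟨ ℕ.*-distribˡ-+ (m ∸ k) (a k) (b (suc k)) ⟩
    (m ∸ k) ℕ.* a k ℕ.+ (m ∸ k) ℕ.* b (suc k)
      ≤⟨ ℕ.+-mono-≤ (a-lym k) (ℕ.*-monoˡ-≤ (b (suc k)) (m∸n≤1+[m∸[1+n]] m k)) ⟩
    suc k ℕ.* a (suc k) ℕ.+ (b (suc k) ℕ.+ (m ∸ suc k) ℕ.* b (suc k))
      ≤⟨ ℕ.+-monoʳ-≤ (suc k ℕ.* a (suc k)) (ℕ.+-mono-≤ (b≤a (suc k)) (b-lym (suc k))) ⟩
    suc k ℕ.* a (suc k) ℕ.+ (a (suc k) ℕ.+ suc (suc k) ℕ.* b (suc (suc k)))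
      ≡⟨ regroup (suc k) (a (suc k)) (b (suc (suc k))) ⟩
    suc (suc k) ℕ.* (a (suc k) ℕ.+ b (suc (suc k))) ∎
    where
    regroup : ∀ s x y → s ℕ.* x ℕ.+ (x ℕ.+ (1 ℕ.+ s) ℕ.* y) ≡ (1 ℕ.+ s) ℕ.* (x ℕ.+ y)
    regroup = ℕ-Solver.solve-∀

reach-mono : ∀ {n m} {G : Graph n m} {S T u v} → S ⊆ T → Reach G S u v → Reach G T u v
reach-mono S⊆T here                 = here
reach-mono S⊆T (step e e∈S ends r) = step e (S⊆T e∈S) ends (reach-mono S⊆T r)

connected-upwardClosed : ∀ {n m} (G : Graph n m) → UpwardClosed (Connected G)
connected-upwardClosed G S⊆T conn u v = reach-mono S⊆T (conn u v)

sumℤ : ℕ → (ℕ → ℤ) → ℤ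
sumℤ zero    f = + 0
sumℤ (suc k) f = sumℤ k f + f k

sumℤ-cong : ∀ k {f g : ℕ → ℤ} → (∀ i → f i ≡ g i) → sumℤ k f ≡ sumℤ k g
sumℤ-cong zero    f≗g = refl
sumℤ-cong (suc k) f≗g = cong₂ _+_ (sumℤ-cong k f≗g) (f≗g k)

sumℤ-shift-difference : ∀ k (f g : ℕ → ℤ) →
  sumℤ (suc k) (λ i → f i - g i) ≡ sumℤ k (λ i → f i - g (suc i)) + f k - g 0
sumℤ-shift-difference zero    f g = ring (f 0) (g 0)
  where
  ring : ∀ a b → + 0 + (a - b) ≡ + 0 + a - b
  ring = solve-∀
sumℤ-shift-difference (suc k) f g rewrite sumℤ-shift-difference k f g =
  ring (sumℤ k (λ i → f i - g (suc i))) (f k) (f (suc k)) (g 0) (g (suc k))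
  where
  ring : ∀ s a a′ b b′ → s + a - b + (a′ - b′) ≡ s + (a - b′) + a′ - b
  ring = solve-∀

module _ (x : ℤ) where

  eval-⊕ : ∀ p q → eval (p ⊕ q) x ≡ eval p x + eval q x
  eval-⊕ []      q       = sym (ℤ.+-identityˡ (eval q x))
  eval-⊕ (a ∷ p) []      = sym (ℤ.+-identityʳ (eval (a ∷ p) x))
  eval-⊕ (a ∷ p) (b ∷ q) rewrite eval-⊕ p q = ring a b (eval p x) (eval q x) x
    where
    ring : ∀ a b u v x → (a + b) + x * (u + v) ≡ (a + x * u) + (b + x * v)
    ring = solve-∀

  eval-scale : ∀ c p → eval (scale c p) x ≡ c * eval p x
  eval-scale c []      = sym (ℤ.*-zeroʳ c)
  eval-scale c (a ∷ p) rewrite eval-scale c p = ring c a (eval p x) x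
    where
    ring : ∀ c a u x → c * a + x * (c * u) ≡ c * (a + x * u)
    ring = solve-∀

  eval-⊗ : ∀ p q → eval (p ⊗ q) x ≡ eval p x * eval q x
  eval-⊗ []      q = sym (ℤ.*-zeroˡ (eval q x))
  eval-⊗ (a ∷ p) q
    rewrite eval-⊕ (scale a q) (+ 0 ∷ (p ⊗ q)) | eval-scale a q | eval-⊗ p q
    = ring a (eval p x) (eval q x) x
    where
    ring : ∀ a u v x → a * v + (+ 0 + x * (u * v)) ≡ (a + x * u) * v
    ring = solve-∀

  eval-derivFrom-suc : ∀ k p → eval (derivFrom (suc k) p) x ≡ eval (derivFrom k p) x + eval p x
  eval-derivFrom-suc k []      = refl
  eval-derivFrom-suc k (a ∷ p) rewrite eval-derivFrom-suc (suc k) p | ℤ.pos-+ 1 k =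
    ring (+ k) a (eval (derivFrom (suc k) p) x) (eval p x) x
    where
    ring : ∀ k a w u x → (+ 1 + k) * a + x * (w + u) ≡ (k * a + x * w) + (a + x * u)
    ring = solve-∀

  eval-deriv-∷ : ∀ a p → eval (deriv (a ∷ p)) x ≡ eval p x + x * eval (deriv p) x
  eval-deriv-∷ a []      = sym (trans (ℤ.+-identityˡ _) (ℤ.*-zeroʳ x))
  eval-deriv-∷ a (b ∷ p) rewrite eval-derivFrom-suc 1 p = ring b (eval (derivFrom 1 p) x) (eval p x) x
    where
    ring : ∀ b w u x → + 1 * b + x * (w + u) ≡ (b + x * u) + x * w
    ring = solve-∀

  eval-deriv-⊕ : ∀ p q → eval (deriv (p ⊕ q)) x ≡ eval (deriv p) x + eval (deriv q) x
  eval-deriv-⊕ []      q       = sym (ℤ.+-identityˡ (eval (deriv q) x))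
  eval-deriv-⊕ (a ∷ p) []      = sym (ℤ.+-identityʳ (eval (deriv (a ∷ p)) x))
  eval-deriv-⊕ (a ∷ p) (b ∷ q)
    rewrite eval-deriv-∷ (a + b) (p ⊕ q) | eval-deriv-∷ a p | eval-deriv-∷ b q
          | eval-⊕ p q | eval-deriv-⊕ p q
    = ring (eval p x) (eval q x) (eval (deriv p) x) (eval (deriv q) x) x
    where
    ring : ∀ u v u′ v′ x → (u + v) + x * (u′ + v′) ≡ (u + x * u′) + (v + x * v′)
    ring = solve-∀

  eval-deriv-scale : ∀ c p → eval (deriv (scale c p)) x ≡ c * eval (deriv p) x
  eval-deriv-scale c []      = sym (ℤ.*-zeroʳ c)
  eval-deriv-scale c (a ∷ p)
    rewrite eval-deriv-∷ (c * a) (scale c p) | eval-deriv-∷ a p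
          | eval-scale c p | eval-deriv-scale c p
    = ring c (eval p x) (eval (deriv p) x) x
    where
    ring : ∀ c u u′ x → c * u + x * (c * u′) ≡ c * (u + x * u′)
    ring = solve-∀

  eval-deriv-⊗ : ∀ p q → eval (deriv (p ⊗ q)) x ≡ eval (deriv p) x * eval q x + eval p x * eval (deriv q) x
  eval-deriv-⊗ []      q = sym (cong₂ _+_ (ℤ.*-zeroˡ (eval q x)) (ℤ.*-zeroˡ (eval (deriv q) x)))
  eval-deriv-⊗ (a ∷ p) q
    rewrite eval-deriv-⊕ (scale a q) (+ 0 ∷ (p ⊗ q)) | eval-deriv-scale a q
          | eval-deriv-∷ (+ 0) (p ⊗ q) | eval-deriv-∷ a p | eval-⊗ p q | eval-deriv-⊗ p q
    = ring a (eval p x) (eval (deriv p) x) (eval q x) (eval (deriv q) x) x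
    where
    ring : ∀ a u u′ v v′ x → a * v′ + (u * v + x * (u′ * v + u * v′))
                            ≡ (u + x * u′) * v + (a + x * u) * v′
    ring = solve-∀

  eval-deriv-^P : ∀ p k → eval (deriv (p ^P k)) x ≡ + k * eval (p ^P ℕ.pred k) x * eval (deriv p) x
  eval-deriv-^P p zero = refl
  eval-deriv-^P p (suc zero) rewrite eval-deriv-⊗ p (constP (+ 1)) = ring (eval (deriv p) x) (eval p x) x
    where
    ring : ∀ u′ u x → u′ * (+ 1 + x * + 0) + u * + 0 ≡ + 1 * (+ 1 + x * + 0) * u′
    ring = solve-∀
  eval-deriv-^P p (suc k@(suc k′)) = begin
    eval (deriv (p ⊗ (p ^P k))) x
      ≡⟨ eval-deriv-⊗ p (p ^P k) ⟩
    p′ * pk + u * eval (deriv (p ^P k)) x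
      ≡⟨ cong (λ e → p′ * pk + u * e) (eval-deriv-^P p k) ⟩
    p′ * pk + u * (+ k * pk′ * p′)
      ≡⟨ cong (λ e → p′ * e + u * (+ k * pk′ * p′)) (eval-⊗ p (p ^P k′)) ⟩
    p′ * (u * pk′) + u * (+ k * pk′ * p′)
      ≡⟨ ring p′ u pk′ (+ k) ⟩
    (+ 1 + + k) * (u * pk′) * p′
      ≡⟨ cong₂ (λ c e → c * e * p′) (ℤ.pos-+ 1 k) (eval-⊗ p (p ^P k′)) ⟨
    + suc k * pk * p′ ∎
    where
    open ≡-Reasoning
    u p′ pk pk′ : ℤ
    u   = eval p x
    p′  = eval (deriv p) x
    pk  = eval (p ^P k) x
    pk′ = eval (p ^P k′) x
    ring : ∀ p′ u w c → p′ * (u * w) + u * (c * w * p′) ≡ (+ 1 + c) * (u * w) * p′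
    ring = solve-∀

  eval-deriv-X : eval (deriv X) x ≡ + 1
  eval-deriv-X = cong (λ t → + 1 + t) (ℤ.*-zeroʳ x)

  eval-deriv-oneMinusX : eval (deriv oneMinusX) x ≡ - + 1
  eval-deriv-oneMinusX = cong (λ t → - + 1 + t) (ℤ.*-zeroʳ x)

  eval-deriv-X^P : ∀ k → eval (deriv (X ^P k)) x ≡ + k * eval (X ^P ℕ.pred k) x
  eval-deriv-X^P k = begin
    eval (deriv (X ^P k)) x                         ≡⟨ eval-deriv-^P X k ⟩
    + k * eval (X ^P ℕ.pred k) x * eval (deriv X) x ≡⟨ cong (+ k * eval (X ^P ℕ.pred k) x *_) eval-deriv-X ⟩
    + k * eval (X ^P ℕ.pred k) x * + 1              ≡⟨ ℤ.*-identityʳ (+ k * eval (X ^P ℕ.pred k) x) ⟩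
    + k * eval (X ^P ℕ.pred k) x                    ∎
    where open ≡-Reasoning

  eval-deriv-oneMinusX^P : ∀ k → eval (deriv (oneMinusX ^P k)) x ≡ - (+ k * eval (oneMinusX ^P ℕ.pred k) x)
  eval-deriv-oneMinusX^P k = begin
    eval (deriv (oneMinusX ^P k)) x ≡⟨ eval-deriv-^P oneMinusX k ⟩
    t * eval (deriv oneMinusX) x    ≡⟨ cong (t *_) eval-deriv-oneMinusX ⟩
    t * - + 1                       ≡⟨ ℤ.neg-distribʳ-* t (+ 1) ⟨
    - (t * + 1)                     ≡⟨ cong -_ (ℤ.*-identityʳ t) ⟩
    - t                             ∎
    where
    open ≡-Reasoning
    t : ℤ
    t = + k * eval (oneMinusX ^P ℕ.pred k) x

  eval-sumP : ∀ k t → eval (sumP k t) x ≡ sumℤ k (λ i → eval (t i) x)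
  eval-sumP zero    t = refl
  eval-sumP (suc k) t = trans (eval-⊕ (sumP k t) (t k)) (cong (_+ eval (t k) x) (eval-sumP k t))

  eval-deriv-sumP : ∀ k t → eval (deriv (sumP k t)) x ≡ sumℤ k (λ i → eval (deriv (t i)) x)
  eval-deriv-sumP zero    t = refl
  eval-deriv-sumP (suc k) t =
    trans (eval-deriv-⊕ (sumP k t) (t k)) (cong (_+ eval (deriv (t k)) x) (eval-deriv-sumP k t))

bernstein : ℕ → ℕ → Poly
bernstein d i = (oneMinusX ^P i) ⊗ (X ^P (d ∸ i))

bernsteinDerivCoeff : ℕ → (ℕ → ℤ) → ℕ → ℤ
bernsteinDerivCoeff d c j = + (suc d ∸ j) * c j - + suc j * c (suc j)

module _ (x : ℤ) where
  open ≡-Reasoning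

  -- At i = 0 the second term has coefficient 0, so the junk value ℕ.pred 0 = 0 is harmless.
  eval-deriv-bernstein : ∀ d i → eval (deriv (bernstein (suc d) i)) x ≡
    + (suc d ∸ i) * eval (bernstein d i) x - + i * eval (bernstein d (ℕ.pred i)) x
  eval-deriv-bernstein d zero = begin
    eval (deriv (oneMinusX ^P 0 ⊗ X ^P suc d)) x
      ≡⟨ eval-deriv-⊗ x (oneMinusX ^P 0) (X ^P suc d) ⟩
    + 0 * eval (X ^P suc d) x + a * eval (deriv (X ^P suc d)) x
      ≡⟨ cong (λ t → + 0 * eval (X ^P suc d) x + a * t) (eval-deriv-X^P x (suc d)) ⟩
    + 0 * eval (X ^P suc d) x + a * (+ suc d * w)
      ≡⟨ ring (eval (X ^P suc d) x) a w (+ suc d) ⟩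
    + suc d * (a * w) - + 0 * (a * w)
      ≡⟨ cong (λ t → + suc d * t - + 0 * t) (eval-⊗ x (oneMinusX ^P 0) (X ^P d)) ⟨
    + suc d * eval (bernstein d 0) x - + 0 * eval (bernstein d 0) x ∎
    where
    a w : ℤ
    a = eval (oneMinusX ^P 0) x
    w = eval (X ^P d) x
    ring : ∀ e a w s → + 0 * e + a * (s * w) ≡ s * (a * w) - + 0 * (a * w)
    ring = solve-∀
  eval-deriv-bernstein d (suc j) = begin
    eval (deriv (oneMinusX ^P suc j ⊗ X ^P (d ∸ j))) x
      ≡⟨ eval-deriv-⊗ x (oneMinusX ^P suc j) (X ^P (d ∸ j)) ⟩
    eval (deriv (oneMinusX ^P suc j)) x * w + a′ * eval (deriv (X ^P (d ∸ j))) x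
      ≡⟨ cong₂ (λ s t → s * w + a′ * t) (eval-deriv-oneMinusX^P x (suc j)) (eval-deriv-X^P x (d ∸ j)) ⟩
    - (+ suc j * a) * w + a′ * (+ (d ∸ j) * eval (X ^P ℕ.pred (d ∸ j)) x)
      ≡⟨ cong (λ k → - (+ suc j * a) * w + a′ * (+ (d ∸ j) * eval (X ^P k) x))
              (ℕ.pred[m∸n]≡m∸[1+n] d j) ⟩
    - (+ suc j * a) * w + a′ * (+ (d ∸ j) * w′)
      ≡⟨ ring (+ suc j) (+ (d ∸ j)) a a′ w w′ ⟩
    + (d ∸ j) * (a′ * w′) - + suc j * (a * w)
      ≡⟨ cong₂ (λ s t → + (d ∸ j) * s - + suc j * t)
               (eval-⊗ x (oneMinusX ^P suc j) (X ^P (d ∸ suc j)))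
               (eval-⊗ x (oneMinusX ^P j) (X ^P (d ∸ j))) ⟨
    + (d ∸ j) * eval (bernstein d (suc j)) x - + suc j * eval (bernstein d j) x ∎
    where
    a a′ w w′ : ℤ
    a  = eval (oneMinusX ^P j) x
    a′ = eval (oneMinusX ^P suc j) x
    w  = eval (X ^P (d ∸ j)) x
    w′ = eval (X ^P (d ∸ suc j)) x
    ring : ∀ i k a a′ w w′ → - (i * a) * w + a′ * (k * w′) ≡ k * (a′ * w′) - i * (a * w)
    ring = solve-∀

  eval-deriv-bernsteinForm : ∀ d c →
    eval (deriv (bernsteinForm (suc d) c)) x ≡ eval (bernsteinForm d (bernsteinDerivCoeff d c)) x
  eval-deriv-bernsteinForm d c = begin
    eval (deriv (sumP (suc (suc d)) term)) x
      ≡⟨ eval-deriv-sumP x (suc (suc d)) term ⟩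
    sumℤ (suc (suc d)) (λ i → eval (deriv (term i)) x)
      ≡⟨ sumℤ-cong (suc (suc d)) deriv-term ⟩
    sumℤ (suc (suc d)) (λ i → up i - down i)
      ≡⟨ sumℤ-shift-difference (suc d) up down ⟩
    sumℤ (suc d) (λ j → up j - down (suc j)) + up (suc d) - down 0
      ≡⟨ boundary-vanishes ⟩
    sumℤ (suc d) (λ j → up j - down (suc j))
      ≡⟨ sumℤ-cong (suc d) merge ⟩
    sumℤ (suc d) (λ j → eval (scale (bernsteinDerivCoeff d c j) (bernstein d j)) x)
      ≡⟨ eval-sumP x (suc d) (λ j → scale (bernsteinDerivCoeff d c j) (bernstein d j)) ⟨
    eval (bernsteinForm d (bernsteinDerivCoeff d c)) x ∎
    where
    term : ℕ → Poly
    term i = scale (c i) (bernstein (suc d) i)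

    b up down : ℕ → ℤ
    b j    = eval (bernstein d j) x
    up i   = c i * (+ (suc d ∸ i) * b i)
    down i = c i * (+ i * b (ℕ.pred i))

    deriv-term : ∀ i → eval (deriv (term i)) x ≡ up i - down i
    deriv-term i = begin
      eval (deriv (scale (c i) (bernstein (suc d) i))) x
        ≡⟨ eval-deriv-scale x (c i) (bernstein (suc d) i) ⟩
      c i * eval (deriv (bernstein (suc d) i)) x
        ≡⟨ cong (c i *_) (eval-deriv-bernstein d i) ⟩
      c i * (+ (suc d ∸ i) * b i - + i * b (ℕ.pred i))
        ≡⟨ ring (c i) (+ (suc d ∸ i) * b i) (+ i * b (ℕ.pred i)) ⟩
      up i - down i ∎
      where
      ring : ∀ c u v → c * (u - v) ≡ c * u - c * v
      ring = solve-∀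

    boundary-vanishes : sumℤ (suc d) (λ j → up j - down (suc j)) + up (suc d) - down 0
                      ≡ sumℤ (suc d) (λ j → up j - down (suc j))
    boundary-vanishes = begin
      s + up (suc d) - down 0
        ≡⟨ cong (λ k → s + c (suc d) * (+ k * b (suc d)) - down 0) (ℕ.n∸n≡0 d) ⟩
      s + c (suc d) * + 0 - c 0 * + 0
        ≡⟨ cong₂ (λ t u → s + t - u) (ℤ.*-zeroʳ (c (suc d))) (ℤ.*-zeroʳ (c 0)) ⟩
      s + + 0 - + 0
        ≡⟨ trans (ℤ.+-identityʳ (s + + 0)) (ℤ.+-identityʳ s) ⟩
      s ∎
      where
      s : ℤ
      s = sumℤ (suc d) (λ j → up j - down (suc j))

    merge : ∀ j → up j - down (suc j) ≡ eval (scale (bernsteinDerivCoeff d c j) (bernstein d j)) x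
    merge j = begin
      up j - down (suc j)
        ≡⟨ ring (c j) (c (suc j)) (+ (suc d ∸ j)) (+ suc j) (b j) ⟩
      bernsteinDerivCoeff d c j * b j
        ≡⟨ eval-scale x (bernsteinDerivCoeff d c j) (bernstein d j) ⟨
      eval (scale (bernsteinDerivCoeff d c j) (bernstein d j)) x ∎
      where
      ring : ∀ c c′ k i b → c * (k * b) - c′ * (i * b) ≡ (k * c - i * c′) * b
      ring = solve-∀

bernsteinDerivCoeff-nonpos : ∀ d (a : ℕ → ℕ) j → (suc d ∸ j) ℕ.* a j ℕ.≤ suc j ℕ.* a (suc j) →
                             bernsteinDerivCoeff d (+_ ∘ a) j ≤ + 0
bernsteinDerivCoeff-nonpos d a j le
  rewrite sym (ℤ.pos-* (suc d ∸ j) (a j)) | sym (ℤ.pos-* (suc j) (a (suc j)))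
  = ℤ.i≤j⇒i-j≤0 (+≤+ le)

proposition2p2 : (n m : ℕ) → m ≥ 1 → (G : Graph n m) →
    (conn? : ∀ S → Dec (Connected G S)) →
    ∃ λ (M : ℕ → ℤ) → (∀ i → M i ≤ + 0) ×
      (∀ (q : ℤ) → eval (deriv (reliability G conn?)) q ≡ eval (bernsteinForm (m ∸ 1) M) q)
proposition2p2 n zero    ()  G conn?
proposition2p2 n (suc d) _   G conn? =
  bernsteinDerivCoeff d N , coeffs-nonpos , λ q → eval-deriv-bernsteinForm q d N
  where
  N : ℕ → ℤ
  N i = + Ncount G conn? i

  coeffs-nonpos : ∀ j → bernsteinDerivCoeff d N j ≤ + 0
  coeffs-nonpos j = bernsteinDerivCoeff-nonpos d (Ncount G conn?) j
    (upwardClosed⇒localLYM (suc d) conn? (connected-upwardClosed G) j)
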